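{- Algorithm Euler-Tour (described in the context), run on a stream of the edges of a finite simple undirected graph $G=(V,E)$ with $n=|V|$ nodes, uses at most $\mathcal{O}(n\log n)$ bits of RAM.
   Context: Setting: $G=(V,E)$ is a finite simple undirected graph with $n=|V|$. It is given as a stream of its edges, each read once in arbitrary order. RAM variables of Euler-Tour: - a counter $c$, initially $0$; - a set $F$ of directed edges, initially $\emptyset$; - a set $E_{\mathrm{int}}$ of undirected edges, initially $\emptyset$; - for each $v\in V$, values $j(v)\in V\cup\{0\}$ and $t(v)\in\mathbb{N}\cup\{0\}$, initially $0$; - auxiliary sets $J$ and $M$ used inside Merge-Cycle. Output: triples $(v_1,v_2,s)$ of nodes with $\{v_1,v_2\}\in E$ are written to an output stream, which is not counted as RAM. Main loop: for each edge $e$ read from the stream, add $e$ to $E_{\mathrm{int}}$. If the graph $(V,E_{\mathrm{int}})$ now contains a cycle $C$, call Merge-Cycle$(C)$ with $C$ written as an ordered cycle $(v_1,\ldots,v_k)$, indices cyclic. Merge-Cycle performs the following steps in order. 1. For $i=1,\ldots,k$: if $t(v_i)=0$, set $j(v_i):=v_{i+1}$ and add $(v_{i-1},v_i)$ to $F$. 2. Set $M:=\emptyset$ and $J:=\emptyset$. For each $j=1,\ldots,|V|$: if some $v_i$ has $t(v_i)=j$, add exactly one such $v_i$ to $J$ and add $j$ to $M$. 3. For each $v_i\in J$: write $(v_{i-1},v_i,j(v_i))$, then set $j(v_i):=v_{i+1}$. 4. For each edge $(v_i,v_{i+1})$ of $C$ that has been neither written nor added to $F$: write $(v_i,v_{i+1},v_{i+2})$.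 5. If $M=\emptyset$, set $c:=c+1$ and $a:=c$; otherwise set $a:=\min M$. For each $v\in V$ with $t(v)\in M$, set $t(v):=a$. For $i=1,\ldots,k$, set $t(v_i):=a$. 6. Delete the edges of $C$ from $E_{\mathrm{int}}$. After the stream ends: - If $E_{\mathrm{int}}\neq\emptyset$, an error is reported. - If there are nodes with $t(u)\ne t(v)\ne 0$, an error is reported. - Finally, for each $(u,v)\in F$, the triple $(u,v,j(v))$ is written. -}

module Defs where

open import Data.Nat using (ℕ; zero; suc; _+_; _*_; _≤_)
open import Data.Nat.Logarithm using (⌊log₂_⌋)
open import Data.Fin using (Fin; toℕ)
open import Data.Fin.Properties using (_≟_)
open import Data.Bool using (Bool; true; false; if_then_else_; _∧_; _∨_; not)
open import Data.Maybe using (Maybe; just; nothing)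
open import Data.Product using (_×_; _,_; proj₁; proj₂)
open import Data.List using (List; []; _∷_; _++_; map; filter; length; allFin;
  reverse; drop; take; zip; upTo; foldl)
open import Data.Bool.ListAction using (any)
open import Data.Nat.ListAction using (sum)
open import Data.List.Relation.Unary.All using (All)
open import Data.List.Relation.Unary.Any using (Any)
open import Data.List.Relation.Unary.AllPairs using (AllPairs)
open import Data.List.Relation.Unary.Unique.Propositional using (Unique)
open import Data.List.Membership.Propositional using (_∈_)
open import Relation.Nullary using (¬_; does)
open import Relation.Binary.PropositionalEquality using (_≡_; _≢_)
import Data.Nat as ℕ

bfilter : ∀ {A : Set} → (A → Bool) → List A → List A
bfilter p [] = []
bfilter p (x ∷ xs) = if p x then x ∷ bfilter p xs else bfilter p xs

Edge : ℕ → Set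
Edge n = Fin n × Fin n

SameEdge : ∀ {n} → Edge n → Edge n → Set
SameEdge (u , v) (u' , v') = (u ≡ u' × v ≡ v') Data.Sum.⊎ (u ≡ v' × v ≡ u')
  where import Data.Sum

sameEdge? : ∀ {n} → Edge n → Edge n → Bool
sameEdge? (u , v) (u' , v') =
  (does (u ≟ u') ∧ does (v ≟ v')) ∨ (does (u ≟ v') ∧ does (v ≟ u'))

_∈ᵤ_ : ∀ {n} → Edge n → List (Edge n) → Set
e ∈ᵤ es = Any (SameEdge e) es

SimpleStream : ∀ {n} → List (Edge n) → Set
SimpleStream es = All (λ e → proj₁ e ≢ proj₂ e) es × AllPairs (λ e e' → ¬ SameEdge e e') es

-- Cycles, written as ordered lists (v₁,…,v_k), indices cyclic

rotL : ∀ {A : Set} → List A → List A     -- (v₂,…,v_k,v₁) : position i holds v_{i+1}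
rotL xs = drop 1 xs ++ take 1 xs

rotR : ∀ {A : Set} → List A → List A     -- (v_k,v₁,…,v_{k-1}) : position i holds v_{i-1}
rotR xs = reverse (rotL (reverse xs))

cycEdges : ∀ {n} → List (Fin n) → List (Edge n)
cycEdges cs = zip cs (rotL cs)

cycTriples : ∀ {n} → List (Fin n) → List (Fin n × Fin n × Fin n)
cycTriples cs = zip (rotR cs) (zip cs (rotL cs))

IsCycle : ∀ {n} → List (Edge n) → List (Fin n) → Set
IsCycle Es cs = (3 ≤ length cs) × Unique cs × All (λ e → e ∈ᵤ Es) (cycEdges cs)

-- successor v_{i+1} of v = v_i on the cycle (v itself if v is not on it)
next : ∀ {n} → List (Fin n) → Fin n → Fin n
next cs v = go (cycEdges cs)
  where
  go : List (Edge _) → Fin _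
  go [] = v
  go ((a , b) ∷ r) = if does (a ≟ v) then b else go r

record State (n : ℕ) : Set where
  constructor st
  field
    c    : ℕ
    F    : List (Edge n)              -- directed edges
    Eint : List (Edge n)              -- undirected edges
    j    : Fin n → Maybe (Fin n)      -- nothing encodes the value 0
    t    : Fin n → ℕ
    J    : List (Fin n)
    M    : List ℕ
open State public

init : (n : ℕ) → State n
init n = st 0 [] [] (λ _ → nothing) (λ _ → 0) [] []

upd : ∀ {n} {A : Set} → (Fin n → A) → Fin n → A → (Fin n → A)
upd f v x u = if does (u ≟ v) then x else f u

isZero : ℕ → Bool
isZero zero = true
isZero (suc _) = false

addEdge : ∀ {n} → Edge n → State n → State n
addEdge e s = record s { Eint = Eint s ++ (e ∷ []) }

step1 : ∀ {n} → List (Fin n) → State n → State n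
step1 cs s = record s
  { j = foldl (λ jj tr → let (p , v , q) = tr in
                 if isZero (t s v) then upd jj v (just q) else jj) (j s) (cycTriples cs)
  ; F = F s ++ map (λ tr → let (p , v , q) = tr in (p , v))
                   (bfilter (λ tr → let (p , v , q) = tr in isZero (t s v)) (cycTriples cs)) }

Mof : ∀ {n} → List (Fin n) → State n → List ℕ
Mof {n} cs s = bfilter (λ k → any (λ v → does (t s v ℕ.≟ k)) cs) (map suc (upTo n))

-- J is a valid choice in Step 2: for each k ∈ M (in order) exactly one v_i with t(v_i) = k
ValidJ : ∀ {n} → List (Fin n) → State n → List (Fin n) → Set
ValidJ cs s Js = (map (t s) Js ≡ Mof cs s) × All (λ v → v ∈ cs) Js

step2 : ∀ {n} → List (Fin n) → List (Fin n) → State n → State n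
step2 cs Js s = record s { J = Js ; M = Mof cs s }

-- Step 3 (the written triples go to the output stream, not RAM)
step3 : ∀ {n} → List (Fin n) → State n → State n
step3 cs s = record s { j = foldl (λ jj v → upd jj v (just (next cs v))) (j s) (J s) }

-- Step 4 only writes to the output stream.

memb : List ℕ → ℕ → Bool
memb ms x = any (λ m → does (m ℕ.≟ x)) ms

step5 : ∀ {n} → List (Fin n) → State n → State n
step5 cs s with M s
... | [] = record s { c = suc (c s)
                    ; t = λ v → if any (λ w → does (w ≟ v)) cs then suc (c s) else t s v }
... | (a ∷ ms) = record s   -- M is increasing, so min M = a
                    { t = λ v → if any (λ w → does (w ≟ v)) cs ∨ memb (a ∷ ms) (t s v)
                                then a else t s v }

step6 : ∀ {n} → List (Fin n) → State n → State n
step6 cs s = record s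
  { Eint = bfilter (λ e → not (any (sameEdge? e) (cycEdges cs))) (Eint s) }

-- Nondeterminism: the orientation/starting point of the cycle C and the
-- choice of J in Step 2.

data Run {n : ℕ} : State n → List (Edge n) → List (State n) → Set where
  done    : ∀ {s} → Run s [] (s ∷ [])
  noCycle : ∀ {s e es tr} →
            (∀ cs → ¬ IsCycle (Eint (addEdge e s)) cs) →
            Run (addEdge e s) es tr →
            Run s (e ∷ es) (s ∷ tr)
  merge   : ∀ {s e es tr} (cs Js : List (Fin n)) →
            let s₀ = addEdge e s
                s₁ = step1 cs s₀
                s₂ = step2 cs Js s₁
                s₃ = step3 cs s₂
                s₅ = step5 cs s₃
                s₆ = step6 cs s₅
            in IsCycle (Eint s₀) cs →
               ValidJ cs s₁ Js →
               Run s₆ es tr →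
               Run s (e ∷ es) (s ∷ s₀ ∷ s₁ ∷ s₂ ∷ s₃ ∷ s₅ ∷ tr)

bitlen : ℕ → ℕ
bitlen x = suc ⌊log₂ x ⌋

-- a node or 0 (values 0..n) takes w = bitlen n bits
bits : ∀ {n} → State n → ℕ
bits {n} s =
    bitlen (c s)
  + length (F s) * (2 * w)
  + length (Eint s) * (2 * w)
  + n * w
  + sum (map (λ v → bitlen (t s v)) (allFin n))
  + length (J s) * w
  + sum (map bitlen (M s))
  where w = bitlen n

-- Every component of the state is a constant number of lists of length O(n) whose
-- entries are at most n, hence takes O(n log n) bits.  Three of these length bounds
-- need an argument.  E_int has at most n + 1 edges: between merges it has no cycle,
-- and a simple graph with more edges than nodes has one (delete nodes of degree at
-- most 1; once none is left, walk until a node repeats).  F has at most n entries: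
-- a node enters F only while its t is 0 and is coloured right after, so the targets
-- of F are distinct.  Finally c ≤ |F|: a fresh colour is taken only when the whole
-- cycle is uncoloured, and then step 1 puts the cycle into F.
module Submission where

open import Defs
open import Data.Bool using (Bool; true; false; T; not; _∨_; _∧_)
open import Data.Bool.ListAction using (any)
open import Data.Bool.Properties using (T?; T-≡; T-∨; T-∧)
open import Data.Empty using (⊥-elim)
open import Data.Fin using (Fin)
open import Data.Fin.Properties using (_≟_; pigeonhole)
open import Data.List
  using (List; []; _∷_; _++_; [_]; length; filter; lookup; allFin; zip; map; reverse; upTo)
open import Data.List.Properties
  using (length-++; length-map; length-reverse; length-tabulate; length-upTo; length-zipWith; map-∘; map-++;
         ++-assoc; filter-notAll)
open import Data.List.Membership.Propositional using (_∈_; find; lose)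
open import Data.List.Membership.Propositional.Properties
  using (∈-lookup; ∈-∃++; ∈-filter⁺; ∈-allFin; ∈-map⁺; ∈-map⁻; ∈-upTo⁺; ∈-upTo⁻)
import Data.List.Membership.DecPropositional as DecMembership
open import Data.List.Relation.Binary.Sublist.Propositional using (_⊆_; []; _∷_; _∷ʳ_; ⊆-refl)
open import Data.List.Relation.Binary.Sublist.Propositional.Properties
  using (filter-⊆; ++⁺; ++⁺ʳ; []⊆-universal; length-mono-≤; All-resp-⊆; Any-resp-⊆)
open import Data.List.Relation.Unary.All using (All; []; _∷_)
import Data.List.Relation.Unary.All as All
open import Data.List.Relation.Unary.All.Properties using (all-filter)
import Data.List.Relation.Unary.All.Properties as All
open import Data.List.Relation.Unary.AllPairs using (AllPairs; []; _∷_)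
open import Data.List.Relation.Unary.Any using (Any; here; there; any?)
import Data.List.Relation.Unary.Any as Any
open import Data.List.Relation.Unary.Any.Properties using (any⁺)
open import Data.List.Relation.Unary.Linked using (Linked; []; [-]; _∷_)
import Data.List.Relation.Unary.Linked as Linked
open import Data.List.Relation.Unary.Unique.Propositional using (Unique)
import Data.List.Relation.Unary.Unique.Propositional.Properties as Unique
open import Data.Nat using (ℕ; zero; suc; _+_; _*_; _≤_; _<_; z≤n; s≤s; ⌊_/2⌋)
open import Data.Nat.Induction using (<-wellFounded)
open import Data.Nat.ListAction using (sum)
open import Data.Nat.Logarithm using (⌊log₂_⌋; ⌈log₂_⌉; ⌊log₂⌋-mono-≤; ⌈log₂⌉-mono-≤; ⌈log₂2^n⌉≡n)
open import Data.Nat.Logarithm.Core using (⌊log2⌋; ⌈log2⌉; ⌈log2⌉-mono-≤)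
open import Data.Nat.Properties renaming (_≟_ to _≟ℕ_)
  using (≡⇒≡ᵇ; ≤-refl; ≤-trans; ≤-reflexive; ≤-pred; <⇒≱; <⇒≢; ≰⇒>; _≤?_; module ≤-Reasoning;
         +-suc; +-comm; +-identityʳ; +-mono-≤; +-monoˡ-≤; +-monoʳ-≤; *-mono-≤; *-monoˡ-≤; *-monoʳ-≤;
         m≤n+m; m≤m+n; m<m+n; m⊓n≤m; m≤n⇒m≤1+n; ⌊n/2⌋≤⌈n/2⌉)
open import Data.Nat.Tactic.RingSolver using (solve-∀)
open import Data.Product using (_×_; _,_; proj₁; proj₂; ∃-syntax; uncurry; map₂)
open import Data.Sum using (_⊎_; inj₁; inj₂)
open import Function using (_∘_; id; case_of_; Equivalence)
open import Induction.WellFounded using (Acc; acc)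
open import Relation.Binary.PropositionalEquality
  using (_≡_; _≢_; refl; sym; trans; cong; subst; _≗_; module ≡-Reasoning)
open import Relation.Nullary using (¬_; Dec; yes; no; ¬?; does)
open import Relation.Nullary.Decidable using (_⊎-dec_; dec-true)
open import Relation.Unary using (Decidable)

module _ {A : Set} where

  AllPairs-resp-⊆ : ∀ {R : A → A → Set} {xs ys} → xs ⊆ ys → AllPairs R ys → AllPairs R xs
  AllPairs-resp-⊆ [] [] = []
  AllPairs-resp-⊆ (_ ∷ʳ sub) (_ ∷ rs) = AllPairs-resp-⊆ sub rs
  AllPairs-resp-⊆ (refl ∷ sub) (r ∷ rs) = All-resp-⊆ sub r ∷ AllPairs-resp-⊆ sub rs

  length-filter-complement : ∀ {P : A → Set} (P? : Decidable P) xs →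
    length xs ≡ length (filter P? xs) + length (filter (¬? ∘ P?) xs)
  length-filter-complement P? [] = refl
  length-filter-complement P? (x ∷ xs) with P? x
  ... | yes _ = cong suc (length-filter-complement P? xs)
  ... | no _ = trans (cong suc (length-filter-complement P? xs)) (sym (+-suc _ _))

  Linked-truncate : ∀ {R : A → A → Set} xs {y z} zs →
    Linked R (xs ++ y ∷ zs) → R y z → Linked R ((xs ++ [ y ]) ++ [ z ])
  Linked-truncate [] zs _ Ryz = Ryz ∷ [-]
  Linked-truncate (x ∷ []) zs (Rxy ∷ L) Ryz = Rxy ∷ Linked-truncate [] zs L Ryz
  Linked-truncate (x ∷ x′ ∷ xs) zs (Rxx′ ∷ L) Ryz = Rxx′ ∷ Linked-truncate (x′ ∷ xs) zs L Ryz

  Linked⇒All-zip : ∀ {R : A → A → Set} x xs {y} →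
    Linked R (x ∷ xs ++ [ y ]) → All (uncurry R) (zip (x ∷ xs) (xs ++ [ y ]))
  Linked⇒All-zip x [] (Rxy ∷ [-]) = Rxy ∷ []
  Linked⇒All-zip x (x′ ∷ xs) (Rxx′ ∷ L) = Rxx′ ∷ Linked⇒All-zip x′ xs L

Unique⇒length≤ : ∀ {n} {xs : List (Fin n)} → Unique xs → length xs ≤ n
Unique⇒length≤ {n} {xs} u with length xs ≤? n
... | yes ≤n = ≤n
... | no ≰n with pigeonhole (≰⇒> ≰n) (lookup xs)
...   | i , j , i<j , eq = ⊥-elim (lookup-distinct u i j i<j eq)
  where
  open import Data.Fin using (zero; suc) renaming (_<_ to _<ᶠ_)
  lookup-distinct : ∀ {ys : List (Fin n)} → Unique ys → ∀ i j → i <ᶠ j → lookup ys i ≢ lookup ys j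
  lookup-distinct (x≢ ∷ _) zero (suc j) _ = All.lookup x≢ (∈-lookup j)
  lookup-distinct (_ ∷ u) (suc i) (suc j) (s≤s i<j) = lookup-distinct u i j i<j

module _ {A : Set} (p : A → Bool) where

  bfilter≗filter : bfilter p ≗ filter (T? ∘ p)
  bfilter≗filter [] = refl
  bfilter≗filter (x ∷ xs) with p x
  ... | true = cong (x ∷_) (bfilter≗filter xs)
  ... | false = bfilter≗filter xs

  bfilter-⊆ : ∀ xs → bfilter p xs ⊆ xs
  bfilter-⊆ xs = subst (_⊆ xs) (sym (bfilter≗filter xs)) (filter-⊆ (T? ∘ p) xs)

  all-bfilter : ∀ xs → All (T ∘ p) (bfilter p xs)
  all-bfilter xs = subst (All (T ∘ p)) (sym (bfilter≗filter xs)) (all-filter (T? ∘ p) xs)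

  ∈-bfilter⁺ : ∀ {x xs} → x ∈ xs → T (p x) → x ∈ bfilter p xs
  ∈-bfilter⁺ {xs = xs} x∈ px = subst (_ ∈_) (sym (bfilter≗filter xs)) (∈-filter⁺ (T? ∘ p) x∈ px)

  bfilter-notAll : ∀ xs → Any (¬_ ∘ T ∘ p) xs → length (bfilter p xs) < length xs
  bfilter-notAll xs rejected =
    subst (λ ys → length ys < length xs) (sym (bfilter≗filter xs)) (filter-notAll (T? ∘ p) xs rejected)

  map-bfilter : ∀ {B : Set} (f : B → A) xs → map f (bfilter (p ∘ f) xs) ≡ bfilter p (map f xs)
  map-bfilter f [] = refl
  map-bfilter f (x ∷ xs) with p (f x)
  ... | true = cong (f x ∷_) (map-bfilter f xs)
  ... | false = map-bfilter f xs

module _ {A B : Set} where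

  map-proj₁-zip : ∀ (xs : List A) (ys : List B) → length xs ≤ length ys → map proj₁ (zip xs ys) ≡ xs
  map-proj₁-zip [] _ _ = refl
  map-proj₁-zip (x ∷ xs) (y ∷ ys) (s≤s short) = cong (x ∷_) (map-proj₁-zip xs ys short)

  map-proj₂-zip : ∀ (xs : List A) (ys : List B) → length ys ≤ length xs → map proj₂ (zip xs ys) ≡ ys
  map-proj₂-zip [] [] _ = refl
  map-proj₂-zip (_ ∷ _) [] _ = refl
  map-proj₂-zip (x ∷ xs) (y ∷ ys) (s≤s short) = cong (y ∷_) (map-proj₂-zip xs ys short)

-- Cycles in simple graphs

module _ {n : ℕ} where

  open DecMembership (_≟_ {n}) using (_∈?_)

  Adj : List (Edge n) → Fin n → Fin n → Set
  Adj Es a b = (a , b) ∈ᵤ Es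

  Adj-sym : ∀ {Es a b} → Adj Es a b → Adj Es b a
  Adj-sym = Any.map λ where
    (inj₁ (p , q)) → inj₂ (q , p)
    (inj₂ (p , q)) → inj₁ (q , p)

  Incident : Fin n → Edge n → Set
  Incident v (a , b) = a ≡ v ⊎ b ≡ v

  incident? : ∀ v → Decidable (Incident v)
  incident? v (a , b) = (a ≟ v) ⊎-dec (b ≟ v)

  other : ∀ {v} e → Incident v e → Fin n
  other (a , b) (inj₁ _) = b
  other (a , b) (inj₂ _) = a

  SameEdge-other : ∀ {v} e (i : Incident v e) → SameEdge (v , other e i) e
  SameEdge-other (a , b) (inj₁ refl) = inj₁ (refl , refl)
  SameEdge-other (a , b) (inj₂ refl) = inj₂ (refl , refl)

  other≢ : ∀ {v} e (i : Incident v e) → proj₁ e ≢ proj₂ e → other e i ≢ v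
  other≢ (a , b) (inj₁ refl) a≢b = a≢b ∘ sym
  other≢ (a , b) (inj₂ refl) a≢b = a≢b

  SameEdge-join : ∀ {x y : Fin n} {e e′} → SameEdge (x , y) e → SameEdge (x , y) e′ → SameEdge e e′
  SameEdge-join (inj₁ (refl , refl)) (inj₁ (refl , refl)) = inj₁ (refl , refl)
  SameEdge-join (inj₁ (refl , refl)) (inj₂ (refl , refl)) = inj₂ (refl , refl)
  SameEdge-join (inj₂ (refl , refl)) (inj₁ (refl , refl)) = inj₂ (refl , refl)
  SameEdge-join (inj₂ (refl , refl)) (inj₂ (refl , refl)) = inj₁ (refl , refl)

  degree : Fin n → List (Edge n) → ℕ
  degree v Es = length (filter (incident? v) Es)

  two-neighbours : ∀ {Es} → SimpleStream Es → ∀ x → 2 ≤ degree x Es →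
    ∃[ y ] ∃[ y′ ] (Adj Es x y × Adj Es x y′ × y ≢ y′ × y ≢ x × y′ ≢ x)
  two-neighbours {Es} (loopless , distinct) x deg≥2 = pick
    (filter (incident? x) Es) deg≥2 (filter-⊆ (incident? x) Es) (all-filter (incident? x) Es)
    where
    pick : ∀ xs → 2 ≤ length xs → xs ⊆ Es → All (Incident x) xs →
      ∃[ y ] ∃[ y′ ] (Adj Es x y × Adj Es x y′ × y ≢ y′ × y ≢ x × y′ ≢ x)
    pick (e ∷ e′ ∷ _) _ sub (i ∷ i′ ∷ _)
      with All-resp-⊆ sub loopless | AllPairs-resp-⊆ sub distinct
    ... | e-loopless ∷ e′-loopless ∷ _ | (e≠e′ ∷ _) ∷ _ =
      other e i , other e′ i′ ,
      Any-resp-⊆ sub (here (SameEdge-other e i)) ,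
      Any-resp-⊆ sub (there (here (SameEdge-other e′ i′))) ,
      (λ y≡y′ → e≠e′ (SameEdge-join (SameEdge-other e i)
                        (subst (λ y → SameEdge (x , y) e′) (sym y≡y′) (SameEdge-other e′ i′)))) ,
      other≢ e i e-loopless , other≢ e′ i′ e′-loopless
    pick (_ ∷ []) (s≤s ()) _ _

  neighbour-avoiding : ∀ {Es} → SimpleStream Es → ∀ x w → 2 ≤ degree x Es →
    ∃[ y ] (Adj Es x y × y ≢ x × y ≢ w)
  neighbour-avoiding ss x w deg≥2 with two-neighbours ss x deg≥2
  ... | y , y′ , xy , xy′ , y≢y′ , y≢x , y′≢x with y ≟ w
  ...   | no y≢w = y , xy , y≢x , y≢w
  ...   | yes refl = y′ , xy′ , y′≢x , y≢y′ ∘ sym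

  MinDegree2 : List (Edge n) → Set
  MinDegree2 Es = ∀ v y → Adj Es v y → 2 ≤ degree v Es

  -- The walk is kept reversed, newest node first; a neighbour of the newest node
  -- either extends it or closes a cycle with an earlier node.
  walk-closes-cycle : ∀ {Es} → SimpleStream Es → MinDegree2 Es →
    ∀ fuel x w ps → n < fuel + length (x ∷ w ∷ ps) → Unique (x ∷ w ∷ ps) →
    Linked (Adj Es) (x ∷ w ∷ ps) → ∃[ cs ] IsCycle Es cs
  walk-closes-cycle ss deg zero x w ps long u _ = ⊥-elim (<⇒≱ long (Unique⇒length≤ u))
  walk-closes-cycle {Es} ss deg (suc fuel) x w ps long u walk
    with neighbour-avoiding ss x w (deg x w (Linked.head walk))
  ... | y , xy , y≢x , y≢w with y ∈? (w ∷ ps)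
  ... | no y∉ = walk-closes-cycle ss deg fuel y x (w ∷ ps) (subst (n <_) (sym (+-suc fuel _)) long)
                  ((y≢x ∷ All.tabulate (λ z∈ → λ { refl → y∉ z∈ })) ∷ u) (Adj-sym xy ∷ walk)
  ... | yes (here y≡w) = ⊥-elim (y≢w y≡w)
  ... | yes (there y∈ps) with ∈-∃++ y∈ps
  ...   | pre , post , refl = x ∷ w ∷ pre ++ [ y ] , three , AllPairs-resp-⊆ cycle⊆walk u ,
          Linked⇒All-zip x (w ∷ pre ++ [ y ]) (Linked-truncate (x ∷ w ∷ pre) post walk (Adj-sym xy))
    where
    cycle⊆walk : x ∷ w ∷ pre ++ [ y ] ⊆ x ∷ w ∷ pre ++ y ∷ post
    cycle⊆walk = refl ∷ refl ∷ ++⁺ ⊆-refl (refl ∷ []⊆-universal post)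
    three : 3 ≤ length (x ∷ w ∷ pre ++ [ y ])
    three = s≤s (s≤s (subst (1 ≤_) (sym (length-++ pre)) (m≤n+m 1 (length pre))))

  SimpleStream-resp-⊆ : ∀ {Es Es′ : List (Edge n)} → Es ⊆ Es′ → SimpleStream Es′ → SimpleStream Es
  SimpleStream-resp-⊆ sub (loopless , distinct) = All-resp-⊆ sub loopless , AllPairs-resp-⊆ sub distinct

  IsCycle-resp-⊆ : ∀ {Es Es′ : List (Edge n)} {cs} → Es ⊆ Es′ → IsCycle Es cs → IsCycle Es′ cs
  IsCycle-resp-⊆ sub (three , unique , edges) = three , unique , All.map (Any-resp-⊆ sub) edges

  cycle-if-MinDegree2 : ∀ {Es} → SimpleStream Es → MinDegree2 Es → 0 < length Es → ∃[ cs ] IsCycle Es cs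
  cycle-if-MinDegree2 {(a , b) ∷ _} ss@(a≢b ∷ _ , _) deg _ =
    walk-closes-cycle ss deg n b a [] (m<m+n n (s≤s z≤n))
      ((a≢b ∘ sym ∷ []) ∷ [] ∷ []) (here (inj₂ (refl , refl)) ∷ [-])

  Covers : List (Fin n) → List (Edge n) → Set
  Covers Vs Es = All (λ e → proj₁ e ∈ Vs × proj₂ e ∈ Vs) Es

  delete-leaf : ∀ {v Vs Es} → v ∈ Vs → degree v Es ≤ 1 → Covers Vs Es → length Vs < length Es →
    ∃[ Vs′ ] ∃[ Es′ ] (Es′ ⊆ Es × length Vs′ < length Vs × Covers Vs′ Es′ × length Vs′ < length Es′)
  delete-leaf {v} {Vs} {Es} v∈ deg≤1 covers many =
    Vs′ , Es′ , filter-⊆ keepE? Es , Vs′<Vs , covers′ , many′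
    where
    keepV? : Decidable (λ u → ¬ u ≡ v)
    keepV? u = ¬? (u ≟ v)
    keepE? : Decidable (λ e → ¬ Incident v e)
    keepE? e = ¬? (incident? v e)
    Vs′ = filter keepV? Vs
    Es′ = filter keepE? Es
    Vs′<Vs : length Vs′ < length Vs
    Vs′<Vs = filter-notAll keepV? Vs (lose v∈ (λ v≢v → v≢v refl))
    covers′ : Covers Vs′ Es′
    covers′ = All.zipWith (λ { {a , b} ((a∈ , b∈) , ¬inc) →
                ∈-filter⁺ keepV? a∈ (¬inc ∘ inj₁) , ∈-filter⁺ keepV? b∈ (¬inc ∘ inj₂) })
              (All-resp-⊆ (filter-⊆ keepE? Es) covers , all-filter keepE? Es)
    many′ : length Vs′ < length Es′
    many′ = ≤-pred (begin
      suc (suc (length Vs′))    ≤⟨ s≤s Vs′<Vs ⟩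
      suc (length Vs)           ≤⟨ many ⟩
      length Es                 ≡⟨ length-filter-complement (incident? v) Es ⟩
      degree v Es + length Es′  ≤⟨ +-monoˡ-≤ (length Es′) deg≤1 ⟩
      suc (length Es′)          ∎)
      where open ≤-Reasoning

  cycle-if-edges-exceed-nodes : ∀ fuel Vs → length Vs ≤ fuel → ∀ {Es} → SimpleStream Es →
    Covers Vs Es → length Vs < length Es → ∃[ cs ] IsCycle Es cs
  cycle-if-edges-exceed-nodes fuel Vs small {Es} ss covers many
    with any? (λ v → degree v Es ≤? 1) Vs
  ... | no none = cycle-if-MinDegree2 ss min-degree (≤-trans (s≤s z≤n) many)
    where
    node∈Vs : ∀ {v y} e → SameEdge (v , y) e → proj₁ e ∈ Vs × proj₂ e ∈ Vs → v ∈ Vs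
    node∈Vs _ (inj₁ (refl , _)) (a∈ , _) = a∈
    node∈Vs _ (inj₂ (refl , _)) (_ , b∈) = b∈
    min-degree : MinDegree2 Es
    min-degree v y vy with find vy
    ... | e , e∈ , same = ≰⇒> (none ∘ lose (node∈Vs e same (All.lookup covers e∈)))
  ... | yes low with find low
  ... | v , v∈ , deg≤1 with delete-leaf v∈ deg≤1 covers many | fuel
  ...   | _ , _ , _ , fewer , _ , _ | zero = ⊥-elim (<⇒≱ (≤-trans fewer small) z≤n)
  ...   | Vs′ , Es′ , sub , fewer , covers′ , many′ | suc fuel′ =
    map₂ (IsCycle-resp-⊆ sub) (cycle-if-edges-exceed-nodes fuel′ Vs′ (≤-pred (≤-trans fewer small))
                         (SimpleStream-resp-⊆ sub ss) covers′ many′)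

  cycle-if-more-than-n-edges : ∀ {Es} → SimpleStream Es → n < length Es → ∃[ cs ] IsCycle Es cs
  cycle-if-more-than-n-edges {Es} ss many =
    cycle-if-edges-exceed-nodes n (allFin n) (≤-reflexive (length-tabulate id)) ss
      (All.tabulate (λ _ → ∈-allFin _ , ∈-allFin _))
      (subst (_< length Es) (sym (length-tabulate id)) many)

-- The steps of Merge-Cycle

length-rotL : ∀ {A : Set} (xs : List A) → length (rotL xs) ≡ length xs
length-rotL [] = refl
length-rotL (x ∷ xs) = trans (length-++ xs) (+-comm (length xs) 1)

length-rotR : ∀ {A : Set} (xs : List A) → length (rotR xs) ≡ length xs
length-rotR xs = trans (length-reverse (rotL (reverse xs)))
                       (trans (length-rotL (reverse xs)) (length-reverse xs))

middles-cycTriples : ∀ {n} (cs : List (Fin n)) → map (proj₁ ∘ proj₂) (cycTriples cs) ≡ cs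
middles-cycTriples cs = begin
  map (proj₁ ∘ proj₂) (cycTriples cs)
    ≡⟨ map-∘ (cycTriples cs) ⟩
  map proj₁ (map proj₂ (zip (rotR cs) (zip cs (rotL cs))))
    ≡⟨ cong (map proj₁) (map-proj₂-zip (rotR cs) _ short) ⟩
  map proj₁ (zip cs (rotL cs))
    ≡⟨ map-proj₁-zip cs (rotL cs) (≤-reflexive (sym (length-rotL cs))) ⟩
  cs
    ∎
  where
  open ≡-Reasoning
  short : length (zip cs (rotL cs)) ≤ length (rotR cs)
  short = ≤-trans (≤-reflexive (length-zipWith _,_ cs (rotL cs)))
                  (≤-trans (m⊓n≤m _ _) (≤-reflexive (sym (length-rotR cs))))

colours : ℕ → List ℕ
colours n = map suc (upTo n)

∈-colours⁻ : ∀ {m n} → m ∈ colours n → 0 < m × m ≤ n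
∈-colours⁻ m∈ with ∈-map⁻ suc m∈
... | _ , k∈ , refl = s≤s z≤n , ∈-upTo⁻ k∈

length-colours : ∀ n → length (colours n) ≡ n
length-colours n = trans (length-map suc (upTo n)) (length-upTo n)

T-isZero : ∀ {m} → T (isZero m) → m ≡ 0
T-isZero {zero} _ = refl

T-does : ∀ {A : Set} (a? : Dec A) → A → T (does a?)
T-does a? a = Equivalence.from T-≡ (dec-true a? a)

T⇒¬T-not : ∀ {b} → T b → ¬ T (not b)
T⇒¬T-not {true} _ ()

module _ {n : ℕ} where

  uncoloured : State n → List (Fin n) → List (Fin n)
  uncoloured s = bfilter (isZero ∘ t s)

  uncoloured-zero : ∀ (s : State n) cs {v} → v ∈ uncoloured s cs → t s v ≡ 0
  uncoloured-zero s cs v∈ = T-isZero (All.lookup (all-bfilter (isZero ∘ t s) cs) v∈)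

  targets-step1 : ∀ cs (s : State n) → map proj₂ (F (step1 cs s)) ≡ map proj₂ (F s) ++ uncoloured s cs
  targets-step1 cs s = begin
    map proj₂ (F (step1 cs s))
      ≡⟨ map-++ proj₂ (F s) _ ⟩
    old ++ map proj₂ (map _ (bfilter _ (cycTriples cs)))
      ≡⟨ cong (old ++_) (sym (map-∘ _)) ⟩
    old ++ map middle (bfilter (isZero ∘ t s ∘ middle) (cycTriples cs))
      ≡⟨ cong (old ++_) (map-bfilter (isZero ∘ t s) middle (cycTriples cs)) ⟩
    old ++ uncoloured s (map middle (cycTriples cs))
      ≡⟨ cong (λ vs → old ++ uncoloured s vs) (middles-cycTriples cs) ⟩
    old ++ uncoloured s cs
      ∎
    where
    open ≡-Reasoning
    old = map proj₂ (F s)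
    middle : Fin n × Fin n × Fin n → Fin n
    middle = proj₁ ∘ proj₂

  length-F-step1 : ∀ cs (s : State n) → length (F (step1 cs s)) ≡ length (F s) + length (uncoloured s cs)
  length-F-step1 cs s = begin
    length (F (step1 cs s))                   ≡⟨ sym (length-map proj₂ (F (step1 cs s))) ⟩
    length (map proj₂ (F (step1 cs s)))       ≡⟨ cong length (targets-step1 cs s) ⟩
    length (map proj₂ (F s) ++ new)           ≡⟨ length-++ (map proj₂ (F s)) ⟩
    length (map proj₂ (F s)) + length new     ≡⟨ cong (_+ length new) (length-map proj₂ (F s)) ⟩
    length (F s) + length new                 ∎
    where
    open ≡-Reasoning
    new = uncoloured s cs

  -- Step 1 adds only uncoloured nodes to F, whose old targets are coloured.
  unique-targets-step1 : ∀ cs (s : State n) → Unique cs → Unique (map proj₂ (F s)) →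
    All (λ e → 0 < t s (proj₂ e)) (F s) → Unique (map proj₂ (F (step1 cs s)))
  unique-targets-step1 cs s unique-cs unique-F coloured-F =
    subst Unique (sym (targets-step1 cs s))
      (Unique.++⁺ unique-F (AllPairs-resp-⊆ (bfilter-⊆ (isZero ∘ t s) cs) unique-cs) disjoint)
    where
    disjoint : ∀ {v} → ¬ (v ∈ map proj₂ (F s) × v ∈ uncoloured s cs)
    disjoint (v∈F , v∈new) with All.lookup (All.map⁺ coloured-F) v∈F | uncoloured-zero s cs v∈new
    ... | 0<tv | tv≡0 = <⇒≢ 0<tv (sym tv≡0)

  Mof⊆colours : ∀ cs (s : State n) → Mof cs s ⊆ colours n
  Mof⊆colours cs s = bfilter-⊆ _ (colours n)

  Mof≡[]⇒uncoloured : ∀ cs (s : State n) → Mof cs s ≡ [] → (∀ v → t s v ≤ n) →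
    ∀ {v} → v ∈ cs → v ∈ uncoloured s cs
  Mof≡[]⇒uncoloured cs s M≡[] t≤n {v} v∈ with t s v in tv≡ | t≤n v
  ... | zero | _ = ∈-bfilter⁺ (isZero ∘ t s) v∈ (subst (T ∘ isZero) (sym tv≡) _)
  ... | suc k | k<n = case subst (suc k ∈_) M≡[] k∈M of λ ()
    where
    occurs : ℕ → Bool
    occurs m = any (λ w → does (t s w ≟ℕ m)) cs
    k∈M : suc k ∈ Mof cs s
    k∈M = ∈-bfilter⁺ occurs (∈-map⁺ suc (∈-upTo⁺ k<n)) (any⁺ _ (lose v∈ (≡⇒≡ᵇ (t s v) (suc k) tv≡)))

  length-Mof≤ : ∀ cs (s : State n) → length (Mof cs s) ≤ n
  length-Mof≤ cs s = subst (length (Mof cs s) ≤_) (length-colours n) (length-mono-≤ (Mof⊆colours cs s))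

  newColour : State n → ℕ
  newColour s with M s
  ... | [] = suc (c s)
  ... | a ∷ _ = a

  newColour-P : ∀ (P : ℕ → Set) (s : State n) → (M s ≡ [] → P (suc (c s))) → All P (M s) → P (newColour s)
  newColour-P P s fresh old with M s | fresh | old
  ... | [] | fresh′ | _ = fresh′ refl
  ... | _ ∷ _ | _ | Pa ∷ _ = Pa

  F-step5 : ∀ cs (s : State n) → F (step5 cs s) ≡ F s
  F-step5 cs s with M s
  ... | [] = refl
  ... | _ ∷ _ = refl

  Eint-step5 : ∀ cs (s : State n) → Eint (step5 cs s) ≡ Eint s
  Eint-step5 cs s with M s
  ... | [] = refl
  ... | _ ∷ _ = refl

  J-step5 : ∀ cs (s : State n) → J (step5 cs s) ≡ J s
  J-step5 cs s with M s
  ... | [] = refl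
  ... | _ ∷ _ = refl

  M-step5 : ∀ cs (s : State n) → M (step5 cs s) ≡ M s
  M-step5 cs s with M s in M≡
  ... | [] = M≡
  ... | _ ∷ _ = M≡

  c-step5 : ∀ (P : ℕ → Set) cs (s : State n) → P (c s) → (M s ≡ [] → P (suc (c s))) → P (c (step5 cs s))
  c-step5 P cs s old fresh with M s | fresh
  ... | [] | fresh′ = fresh′ refl
  ... | _ ∷ _ | _ = old

  t-step5 : ∀ (P : ℕ → Set) cs (s : State n) v → P (t s v) → P (newColour s) → P (t (step5 cs s) v)
  t-step5 P cs s v old new with M s | new
  ... | [] | new′ with any (λ w → does (w ≟ v)) cs
  ...   | true = new′
  ...   | false = old
  t-step5 P cs s v old new | a ∷ ms | new′ with any (λ w → does (w ≟ v)) cs ∨ memb (a ∷ ms) (t s v)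
  ...   | true = new′
  ...   | false = old

  any-≟-∈ : ∀ {v} {cs : List (Fin n)} → v ∈ cs → any (λ w → does (w ≟ v)) cs ≡ true
  any-≟-∈ {v} v∈ = Equivalence.to T-≡ (any⁺ (λ w → does (w ≟ v)) (lose v∈ (T-does (v ≟ v) refl)))

  t-step5-∈ : ∀ cs (s : State n) {v} → v ∈ cs → t (step5 cs s) v ≡ newColour s
  t-step5-∈ cs s v∈ with M s
  ... | [] rewrite any-≟-∈ v∈ = refl
  ... | _ ∷ _ rewrite any-≟-∈ v∈ = refl

  SameEdge⇒sameEdge? : ∀ {a b : Fin n} e → SameEdge (a , b) e → T (sameEdge? e (a , b))
  SameEdge⇒sameEdge? {a} {b} _ (inj₁ (refl , refl)) =
    Equivalence.from (T-∨ {does (a ≟ a) ∧ does (b ≟ b)})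
      (inj₁ (Equivalence.from T-∧ (T-does (a ≟ a) refl , T-does (b ≟ b) refl)))
  SameEdge⇒sameEdge? {a} {b} _ (inj₂ (refl , refl)) =
    Equivalence.from (T-∨ {does (b ≟ a) ∧ does (a ≟ b)})
      (inj₂ (Equivalence.from T-∧ (T-does (b ≟ b) refl , T-does (a ≟ a) refl)))

  step6-removes-an-edge : ∀ cs (s : State n) → IsCycle (Eint s) cs →
    length (Eint (step6 cs s)) < length (Eint s)
  step6-removes-an-edge cs@(_ ∷ _ ∷ _) s (_ , _ , first-edge ∷ _) =
    bfilter-notAll _ (Eint s) (Any.map
      (λ {e} same → T⇒¬T-not (any⁺ {xs = cycEdges cs} (sameEdge? e) (here (SameEdge⇒sameEdge? e same))))
      first-edge)
  step6-removes-an-edge (_ ∷ []) s (s≤s () , _)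

-- Invariants of a run

length≤n-if-unique-targets : ∀ {n} (Fs : List (Edge n)) → Unique (map proj₂ Fs) → length Fs ≤ n
length≤n-if-unique-targets Fs unique = subst (_≤ _) (length-map proj₂ Fs) (Unique⇒length≤ unique)

record Bounded {n : ℕ} (s : State n) : Set where
  field
    c≤n        : c s ≤ n
    ∣F∣≤n      : length (F s) ≤ n
    ∣Eint∣≤1+n : length (Eint s) ≤ suc n
    t≤n        : ∀ v → t s v ≤ n
    ∣J∣≤n      : length (J s) ≤ n
    M⊆colours  : M s ⊆ colours n

-- Holds whenever the next edge is about to be read, es being the rest of the stream.
record Invariant {n : ℕ} (s : State n) (es : List (Edge n)) : Set where
  field
    c≤∣F∣            : c s ≤ length (F s)
    unique-targets   : Unique (map proj₂ (F s))
    coloured-targets : All (λ e → 0 < t s (proj₂ e)) (F s)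
    t≤n              : ∀ v → t s v ≤ n
    simple           : SimpleStream (Eint s ++ es)
    ∣Eint∣≤n         : length (Eint s) ≤ n
    ∣J∣≤n            : length (J s) ≤ n
    M⊆colours        : M s ⊆ colours n

-- The state between steps 3 and 5 of Merge-Cycle on the cycle cs.
record Recolourable {n : ℕ} (cs : List (Fin n)) (s : State n) (es : List (Edge n)) : Set where
  field
    cycle                : IsCycle (Eint s) cs
    simple               : SimpleStream (Eint s ++ es)
    ∣Eint∣≤1+n           : length (Eint s) ≤ suc n
    c≤∣F∣                : c s ≤ length (F s)
    fresh-colour≤∣F∣     : M s ≡ [] → suc (c s) ≤ length (F s)
    unique-targets       : Unique (map proj₂ (F s))
    coloured-or-on-cycle : All (λ e → 0 < t s (proj₂ e) ⊎ proj₂ e ∈ cs) (F s)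
    t≤n                  : ∀ v → t s v ≤ n
    ∣J∣≤n                : length (J s) ≤ n
    M⊆colours            : M s ⊆ colours n

module _ {n : ℕ} where

  Invariant⇒Bounded : ∀ {s : State n} {es} → Invariant s es → Bounded s
  Invariant⇒Bounded {s} inv = record
    { Invariant inv using (t≤n; ∣J∣≤n; M⊆colours)
    ; c≤n = ≤-trans c≤∣F∣ ∣F∣≤n ; ∣F∣≤n = ∣F∣≤n ; ∣Eint∣≤1+n = m≤n⇒m≤1+n ∣Eint∣≤n }
    where
    open Invariant inv
    ∣F∣≤n = length≤n-if-unique-targets (F s) unique-targets

  Recolourable⇒Bounded : ∀ {cs} {s : State n} {es} → Recolourable cs s es → Bounded s
  Recolourable⇒Bounded {s = s} r = record
    { Recolourable r using (∣Eint∣≤1+n; t≤n; ∣J∣≤n; M⊆colours)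
    ; c≤n = ≤-trans c≤∣F∣ ∣F∣≤n ; ∣F∣≤n = ∣F∣≤n }
    where
    open Recolourable r
    ∣F∣≤n = length≤n-if-unique-targets (F s) unique-targets

  invariant-init : ∀ {es} → SimpleStream es → Invariant (init n) es
  invariant-init simple = record
    { c≤∣F∣ = z≤n ; unique-targets = [] ; coloured-targets = [] ; t≤n = λ _ → z≤n
    ; simple = simple ; ∣Eint∣≤n = z≤n ; ∣J∣≤n = z≤n ; M⊆colours = []⊆-universal _ }

  simple-addEdge : ∀ {s : State n} {e es} →
    SimpleStream (Eint s ++ e ∷ es) → SimpleStream (Eint (addEdge e s) ++ es)
  simple-addEdge {s} {e} {es} = subst SimpleStream (sym (++-assoc (Eint s) [ e ] es))

  -- Between merges E_int has no cycle, so it has at most n edges.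
  invariant-addEdge : ∀ {s : State n} {e es} → Invariant s (e ∷ es) →
    (∀ cs → ¬ IsCycle (Eint (addEdge e s)) cs) → Invariant (addEdge e s) es
  invariant-addEdge {s} {e} {es} inv acyclic = record
    { Invariant inv hiding (simple; ∣Eint∣≤n) ; simple = simple₀ ; ∣Eint∣≤n = ∣Eint₀∣≤n }
    where
    open Invariant inv
    simple₀ = simple-addEdge {s} simple
    ∣Eint₀∣≤n : length (Eint s ++ [ e ]) ≤ n
    ∣Eint₀∣≤n with length (Eint s ++ [ e ]) ≤? n
    ... | yes ≤n = ≤n
    ... | no ≰n with cycle-if-more-than-n-edges (SimpleStream-resp-⊆ (++⁺ʳ es ⊆-refl) simple₀) (≰⇒> ≰n)
    ...   | cs , cyc = ⊥-elim (acyclic cs cyc)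

  recolour : ∀ {cs} {s : State n} {es} → Recolourable cs s es →
    Bounded (step5 cs s) × Invariant (step6 cs (step5 cs s)) es
  recolour {cs} {s} {es} r = bounded₅ , invariant₆
    where
    open Recolourable r
    s₅ = step5 cs s
    ∣F∣≤n = length≤n-if-unique-targets (F s) unique-targets
    colour-range : 0 < newColour s × newColour s ≤ n
    colour-range = newColour-P (λ m → 0 < m × m ≤ n) s
      (λ M≡[] → s≤s z≤n , ≤-trans (fresh-colour≤∣F∣ M≡[]) ∣F∣≤n)
      (All-resp-⊆ M⊆colours (All.tabulate ∈-colours⁻))
    c₅≤∣F∣ : c s₅ ≤ length (F s)
    c₅≤∣F∣ = c-step5 (_≤ length (F s)) cs s c≤∣F∣ fresh-colour≤∣F∣
    t₅≤n : ∀ v → t s₅ v ≤ n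
    t₅≤n v = t-step5 (_≤ n) cs s v (t≤n v) (proj₂ colour-range)
    coloured₅ : All (λ e → 0 < t s₅ (proj₂ e)) (F s)
    coloured₅ = All.map (recoloured _) coloured-or-on-cycle
      where
      recoloured : ∀ v → 0 < t s v ⊎ v ∈ cs → 0 < t s₅ v
      recoloured v (inj₁ 0<tv) = t-step5 (0 <_) cs s v 0<tv (proj₁ colour-range)
      recoloured v (inj₂ v∈cs) = subst (0 <_) (sym (t-step5-∈ cs s v∈cs)) (proj₁ colour-range)
    Eint₅≡ = Eint-step5 cs s
    F₅≡ = F-step5 cs s
    ∣Eint₅∣≤1+n : length (Eint s₅) ≤ suc n
    ∣Eint₅∣≤1+n = subst (λ E → length E ≤ suc n) (sym Eint₅≡) ∣Eint∣≤1+n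
    bounded₅ : Bounded s₅
    bounded₅ = record
      { c≤n = ≤-trans c₅≤∣F∣ ∣F∣≤n ; ∣F∣≤n = subst (λ Fs → length Fs ≤ n) (sym F₅≡) ∣F∣≤n
      ; ∣Eint∣≤1+n = ∣Eint₅∣≤1+n ; t≤n = t₅≤n
      ; ∣J∣≤n = subst (λ Js → length Js ≤ n) (sym (J-step5 cs s)) ∣J∣≤n
      ; M⊆colours = subst (_⊆ colours n) (sym (M-step5 cs s)) M⊆colours }
    invariant₆ : Invariant (step6 cs s₅) es
    invariant₆ = record
      { c≤∣F∣ = subst (λ Fs → c s₅ ≤ length Fs) (sym F₅≡) c₅≤∣F∣
      ; unique-targets = subst (Unique ∘ map proj₂) (sym F₅≡) unique-targets
      ; coloured-targets = subst (All (λ e → 0 < t s₅ (proj₂ e))) (sym F₅≡) coloured₅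
      ; Bounded bounded₅ using (t≤n; ∣J∣≤n; M⊆colours)
      ; simple = SimpleStream-resp-⊆ (++⁺ (bfilter-⊆ _ (Eint s₅)) ⊆-refl)
                   (subst (λ E → SimpleStream (E ++ es)) (sym Eint₅≡) simple)
      ; ∣Eint∣≤n = ≤-pred (≤-trans (step6-removes-an-edge cs s₅ cycle₅) ∣Eint₅∣≤1+n) }
      where
      cycle₅ = subst (λ E → IsCycle E cs) (sym Eint₅≡) cycle

  fresh-colour-grows-F : ∀ cs (s : State n) → 0 < length cs → Mof cs s ≡ [] → (∀ v → t s v ≤ n) →
    length (F s) < length (F (step1 cs s))
  fresh-colour-grows-F cs@(_ ∷ _) s _ M≡[] t≤n = begin-strict
    length (F s)                               <⟨ m<m+n (length (F s)) (nonempty head-uncoloured) ⟩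
    length (F s) + length (uncoloured s cs)    ≡⟨ sym (length-F-step1 cs s) ⟩
    length (F (step1 cs s))                    ∎
    where
    open ≤-Reasoning
    head-uncoloured = Mof≡[]⇒uncoloured cs s M≡[] t≤n (here refl)
    nonempty : ∀ {v : Fin n} {vs} → v ∈ vs → 0 < length vs
    nonempty (here _) = s≤s z≤n
    nonempty (there _) = s≤s z≤n

  merge-until-recolouring : ∀ {s : State n} {e es} cs Js → Invariant s (e ∷ es) →
    let s₀ = addEdge e s ; s₁ = step1 cs s₀ ; s₂ = step2 cs Js s₁ in
    IsCycle (Eint s₀) cs → ValidJ cs s₁ Js →
    Bounded s₀ × Bounded s₁ × Bounded s₂ × Recolourable cs (step3 cs s₂) es
  merge-until-recolouring {s} {e} {es} cs Js inv cyc@(three , unique-cs , _) (t[Js]≡M , _) =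
    bounded₀ , bounded₁ , bounded₂ , recolourable₃
    where
    open Invariant inv
    s₀ = addEdge e s
    s₁ = step1 cs s₀
    ∣Eint₀∣≤1+n : length (Eint s₀) ≤ suc n
    ∣Eint₀∣≤1+n = subst (_≤ suc n) (sym (trans (length-++ (Eint s)) (+-comm _ 1))) (s≤s ∣Eint∣≤n)
    unique₁ = unique-targets-step1 cs s₀ unique-cs unique-targets coloured-targets
    ∣F₁∣≤n = length≤n-if-unique-targets (F s₁) unique₁
    ∣F∣≤∣F₁∣ : length (F s) ≤ length (F s₁)
    ∣F∣≤∣F₁∣ = subst (length (F s) ≤_) (sym (length-F-step1 cs s₀)) (m≤m+n _ _)
    ∣Js∣≤n : length Js ≤ n
    ∣Js∣≤n = subst (_≤ n) (trans (cong length (sym t[Js]≡M)) (length-map (t s) Js)) (length-Mof≤ cs s₀)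
    coloured-or-on-cycle₁ : All (λ e → 0 < t s (proj₂ e) ⊎ proj₂ e ∈ cs) (F s₁)
    coloured-or-on-cycle₁ = All.map⁻ (subst (All _) (sym (targets-step1 cs s₀))
      (All.++⁺ (All.map⁺ (All.map inj₁ coloured-targets))
               (All.tabulate (inj₂ ∘ Any-resp-⊆ (bfilter-⊆ _ cs)))))
    bounded₀ : Bounded s₀
    bounded₀ = record { Bounded (Invariant⇒Bounded inv) hiding (∣Eint∣≤1+n) ; ∣Eint∣≤1+n = ∣Eint₀∣≤1+n }
    bounded₁ : Bounded s₁
    bounded₁ = record { Bounded bounded₀ hiding (∣F∣≤n) ; ∣F∣≤n = ∣F₁∣≤n }
    recolourable₃ : Recolourable cs (step3 cs (step2 cs Js s₁)) es
    recolourable₃ = record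
      { cycle = cyc ; simple = simple-addEdge {s} simple ; ∣Eint∣≤1+n = ∣Eint₀∣≤1+n
      ; c≤∣F∣ = ≤-trans c≤∣F∣ ∣F∣≤∣F₁∣
      ; fresh-colour≤∣F∣ = λ M≡[] →
          ≤-trans (s≤s c≤∣F∣) (fresh-colour-grows-F cs s₀ (≤-trans (s≤s z≤n) three) M≡[] t≤n)
      ; unique-targets = unique₁ ; coloured-or-on-cycle = coloured-or-on-cycle₁ ; t≤n = t≤n
      ; ∣J∣≤n = ∣Js∣≤n ; M⊆colours = Mof⊆colours cs s₀ }
    bounded₂ : Bounded (step2 cs Js s₁)
    bounded₂ = record { Bounded (Recolourable⇒Bounded recolourable₃) }

  run-bounded : ∀ {s : State n} {es tr} → Invariant s es → Run s es tr → All Bounded tr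
  run-bounded inv done = Invariant⇒Bounded inv ∷ []
  run-bounded inv (noCycle acyclic run) =
    Invariant⇒Bounded inv ∷ run-bounded (invariant-addEdge inv acyclic) run
  run-bounded inv (merge cs Js cyc validJ run) with merge-until-recolouring cs Js inv cyc validJ
  ... | b₀ , b₁ , b₂ , r₃ with recolour r₃
  ...   | b₅ , inv₆ =
    Invariant⇒Bounded inv ∷ b₀ ∷ b₁ ∷ b₂ ∷ Recolourable⇒Bounded r₃ ∷ b₅ ∷ run-bounded inv₆ run

-- Counting bits

⌊log2⌋≤⌈log2⌉ : ∀ m (acc acc′ : Acc _<_ m) → ⌊log2⌋ m acc ≤ ⌈log2⌉ m acc′
⌊log2⌋≤⌈log2⌉ 0 _ _ = z≤n
⌊log2⌋≤⌈log2⌉ 1 _ _ = z≤n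
⌊log2⌋≤⌈log2⌉ (suc (suc m)) (acc rs) (acc rs′) =
  s≤s (≤-trans (⌊log2⌋≤⌈log2⌉ (suc ⌊ m /2⌋) (rs _) (<-wellFounded _))
               (⌈log2⌉-mono-≤ (s≤s (⌊n/2⌋≤⌈n/2⌉ m))))

⌊log₂⌋≤⌈log₂⌉ : ∀ m → ⌊log₂ m ⌋ ≤ ⌈log₂ m ⌉
⌊log₂⌋≤⌈log₂⌉ m = ⌊log2⌋≤⌈log2⌉ m (<-wellFounded m) (<-wellFounded m)

bitlen-mono-≤ : ∀ {a b} → a ≤ b → bitlen a ≤ bitlen b
bitlen-mono-≤ a≤b = s≤s (⌊log₂⌋-mono-≤ a≤b)

bitlen≤2*⌈log₂⌉ : ∀ {m} → 2 ≤ m → bitlen m ≤ 2 * ⌈log₂ m ⌉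
bitlen≤2*⌈log₂⌉ {m} 2≤m = begin
  suc ⌊log₂ m ⌋             ≤⟨ +-mono-≤ 1≤⌈log₂m⌉ (⌊log₂⌋≤⌈log₂⌉ m) ⟩
  ⌈log₂ m ⌉ + ⌈log₂ m ⌉     ≡⟨ cong (⌈log₂ m ⌉ +_) (sym (+-identityʳ _)) ⟩
  2 * ⌈log₂ m ⌉             ∎
  where
  open ≤-Reasoning
  1≤⌈log₂m⌉ : 1 ≤ ⌈log₂ m ⌉
  1≤⌈log₂m⌉ = subst (_≤ ⌈log₂ m ⌉) (⌈log₂2^n⌉≡n 1) (⌈log₂⌉-mono-≤ 2≤m)

sum-map-≤ : ∀ {A : Set} (f : A → ℕ) {b} xs → All (λ x → f x ≤ b) xs → sum (map f xs) ≤ length xs * b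
sum-map-≤ f [] [] = z≤n
sum-map-≤ f (x ∷ xs) (fx≤b ∷ fxs≤b) = +-mono-≤ fx≤b (sum-map-≤ f xs fxs≤b)

bits≤[8n+3]*bitlen : ∀ {n} (s : State n) → Bounded s → bits s ≤ (8 * n + 3) * bitlen n
bits≤[8n+3]*bitlen {n} s b = ≤-trans
  (c-bits ⊕ F-bits ⊕ Eint-bits ⊕ ≤-refl ⊕ t-bits ⊕ J-bits ⊕ M-bits)
  (≤-reflexive (total w n))
  where
  open Bounded b
  w = bitlen n
  infixl 6 _⊕_
  _⊕_ = +-mono-≤
  c-bits : bitlen (c s) ≤ w
  c-bits = bitlen-mono-≤ c≤n
  F-bits : length (F s) * (2 * w) ≤ n * (2 * w)
  F-bits = *-monoˡ-≤ (2 * w) ∣F∣≤n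
  Eint-bits : length (Eint s) * (2 * w) ≤ suc n * (2 * w)
  Eint-bits = *-monoˡ-≤ (2 * w) ∣Eint∣≤1+n
  t-bits : sum (map (λ v → bitlen (t s v)) (allFin n)) ≤ n * w
  t-bits = subst (λ k → sum (map (bitlen ∘ t s) (allFin n)) ≤ k * w) (length-tabulate {n = n} id)
             (sum-map-≤ (bitlen ∘ t s) (allFin n) (All.tabulate (λ {v} _ → bitlen-mono-≤ (t≤n v))))
  J-bits : length (J s) * w ≤ n * w
  J-bits = *-monoˡ-≤ w ∣J∣≤n
  M-bits : sum (map bitlen (M s)) ≤ n * w
  M-bits = ≤-trans
    (sum-map-≤ bitlen (M s) (All-resp-⊆ M⊆colours (All.tabulate (bitlen-mono-≤ ∘ proj₂ ∘ ∈-colours⁻))))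
    (*-monoˡ-≤ w (subst (length (M s) ≤_) (length-colours n) (length-mono-≤ M⊆colours)))
  total : ∀ w n → w + n * (2 * w) + suc n * (2 * w) + n * w + n * w + n * w + n * w ≡ (8 * n + 3) * w
  total = solve-∀

[8n+3]*bitlen≤22*n*⌈log₂n⌉ : ∀ {n} → 2 ≤ n → (8 * n + 3) * bitlen n ≤ 22 * (n * ⌈log₂ n ⌉)
[8n+3]*bitlen≤22*n*⌈log₂n⌉ {n} 2≤n = begin
  (8 * n + 3) * bitlen n             ≤⟨ *-mono-≤ 8n+3≤11n (bitlen≤2*⌈log₂⌉ 2≤n) ⟩
  (11 * n) * (2 * ⌈log₂ n ⌉)         ≡⟨ regroup n ⌈log₂ n ⌉ ⟩
  22 * (n * ⌈log₂ n ⌉)               ∎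
  where
  open ≤-Reasoning
  8n+3≤11n : 8 * n + 3 ≤ 11 * n
  8n+3≤11n = ≤-trans (+-monoʳ-≤ (8 * n) (*-monoʳ-≤ 3 (≤-trans (s≤s z≤n) 2≤n))) (≤-reflexive (split n))
    where
    split : ∀ n → 8 * n + 3 * n ≡ 11 * n
    split = solve-∀
  regroup : ∀ n l → (11 * n) * (2 * l) ≡ 22 * (n * l)
  regroup = solve-∀

lemma4 : ∃[ K ] ∃[ N ] ((n : ℕ) → N ≤ n → (es : List (Edge n)) → SimpleStream es →
           (tr : List (State n)) → Run (init n) es tr →
           All (λ s → bits s ≤ K * (n * ⌈log₂ n ⌉)) tr)
lemma4 = 22 , 2 , λ n 2≤n es simple tr run →
  All.map (λ {s} bounded → ≤-trans (bits≤[8n+3]*bitlen s bounded) ([8n+3]*bitlen≤22*n*⌈log₂n⌉ 2≤n))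
          (run-bounded (invariant-init simple) run)
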